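{- Let $M\in H$ and $\delta,\delta'\in\Delta_2$ with $M\delta=\delta'$. If $\delta$ is odd, then $M=I$ or $M=J$, and in the latter case $\delta\in\{(1,0,1),(-1,0,-1)\}$. If $\delta$ is even, then $M=I$. In all cases $\delta=\delta'$.
   Context: Vectors are column vectors. $B=\begin{pmatrix}3&4&0\\2&3&0\\0&0&1\end{pmatrix}$, $J=\begin{pmatrix}0&0&1\\0&1&0\\1&0&0\end{pmatrix}$, $I$ is the identity, and $H$ is the subgroup of $\mathrm{GL}_3(\mathbb{Z})$ generated by $B$ and $J$. $\Delta_2=\{(2,1,0),(-2,1,0),(1,0,1),(-1,0,1),(-1,0,-1)\}$; its elements $(1,0,1),(-1,0,1),(-1,0,-1)$ are called odd and $(2,1,0),(-2,1,0)$ are called even. -}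

module Defs where

open import Data.Integer using (ℤ; +_; -[1+_]; _+_; _*_; -_)
open import Data.Fin using (Fin; zero; suc)
open import Data.Product using (_×_; _,_)
open import Data.Sum using (_⊎_)
open import Relation.Binary.PropositionalEquality using (_≡_)

-- 3×3 integer matrices as functions (row index, column index).
Mat3 : Set
Mat3 = Fin 3 → Fin 3 → ℤ

Vec3 : Set
Vec3 = Fin 3 → ℤ

mat : ℤ → ℤ → ℤ → ℤ → ℤ → ℤ → ℤ → ℤ → ℤ → Mat3
mat a b c d e f g h i zero zero = a
mat a b c d e f g h i zero (suc zero) = b
mat a b c d e f g h i zero (suc (suc zero)) = c
mat a b c d e f g h i (suc zero) zero = d
mat a b c d e f g h i (suc zero) (suc zero) = e
mat a b c d e f g h i (suc zero) (suc (suc zero)) = f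
mat a b c d e f g h i (suc (suc zero)) zero = g
mat a b c d e f g h i (suc (suc zero)) (suc zero) = h
mat a b c d e f g h i (suc (suc zero)) (suc (suc zero)) = i

vec : ℤ → ℤ → ℤ → Vec3
vec x y z zero = x
vec x y z (suc zero) = y
vec x y z (suc (suc zero)) = z

_⊗_ : Mat3 → Mat3 → Mat3
(M ⊗ N) r c = M r zero * N zero c + (M r (suc zero) * N (suc zero) c + M r (suc (suc zero)) * N (suc (suc zero)) c)

_·_ : Mat3 → Vec3 → Vec3
(M · v) r = M r zero * v zero + (M r (suc zero) * v (suc zero) + M r (suc (suc zero)) * v (suc (suc zero)))

_≈M_ : Mat3 → Mat3 → Set
M ≈M N = ∀ r c → M r c ≡ N r c

_≈V_ : Vec3 → Vec3 → Set
u ≈V v = ∀ r → u r ≡ v r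

I₃ : Mat3
I₃ = mat (+ 1) (+ 0) (+ 0) (+ 0) (+ 1) (+ 0) (+ 0) (+ 0) (+ 1)

B : Mat3
B = mat (+ 3) (+ 4) (+ 0) (+ 2) (+ 3) (+ 0) (+ 0) (+ 0) (+ 1)

B⁻¹ : Mat3
B⁻¹ = mat (+ 3) (- (+ 4)) (+ 0) (- (+ 2)) (+ 3) (+ 0) (+ 0) (+ 0) (+ 1)

J : Mat3
J = mat (+ 0) (+ 0) (+ 1) (+ 0) (+ 1) (+ 0) (+ 1) (+ 0) (+ 0)

-- H = subgroup of GL₃(ℤ) generated by B and J: the words in B, B⁻¹, J
-- (every element of a generated subgroup is a finite product of generators
-- and their inverses).
data InH : Mat3 → Set where
  h-I   : InH I₃
  h-B   : ∀ {M} → InH M → InH (B ⊗ M)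
  h-B⁻¹ : ∀ {M} → InH M → InH (B⁻¹ ⊗ M)
  h-J   : ∀ {M} → InH M → InH (J ⊗ M)

data OddΔ₂ : Vec3 → Set where
  o1 : OddΔ₂ (vec (+ 1) (+ 0) (+ 1))
  o2 : OddΔ₂ (vec (- (+ 1)) (+ 0) (+ 1))
  o3 : OddΔ₂ (vec (- (+ 1)) (+ 0) (- (+ 1)))

data EvenΔ₂ : Vec3 → Set where
  e1 : EvenΔ₂ (vec (+ 2) (+ 1) (+ 0))
  e2 : EvenΔ₂ (vec (- (+ 2)) (+ 1) (+ 0))

data InΔ₂ : Vec3 → Set where
  odd  : ∀ {v} → OddΔ₂ v → InΔ₂ v
  even : ∀ {v} → EvenΔ₂ v → InΔ₂ v

-- Ping-pong.  B acts on (x, y) as the Pell unit 3 + 2√2 and fixes z, J swaps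
-- x and z, and Δ₂ lies on the H-invariant quadric x² + z² - 2y² = 2.  Every
-- element of H realises a reduced word in B, B⁻¹, J.  There are three disjoint
-- zones: the B-zone (the cone x > y ≥ |z|, x ≥ 3, up to sign, plus one
-- exceptional point), its image under σ = diag(-1, 1, -1), which conjugates B
-- into B⁻¹ and commutes with J, and the J-zone (|x| ≤ y < |z| up to sign).
-- A reduced word sends a seed (a point of Δ₂ or (1,0,-1)) into the zone of its
-- first letter, except that the word J may return a seed; the one quadratic
-- estimate needed is quadric-bound.  Seeds lie in no zone, so a word mapping
-- Δ₂ into Δ₂ is empty or J; a matrix is determined by its action, and a finite
-- check on Δ₂ finishes.

module Submission where

open import Defs
open import Data.Integer using (+_; -_)
open import Data.Product using (_×_)
open import Data.Sum using (_⊎_)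

open import Data.Integer using (ℤ; -[1+_]; _+_; _*_; _-_; NonNegative)
open import Data.Integer.Properties using (pos-*)
open import Data.Integer.Tactic.RingSolver using (solve; solve-∀)
open import Data.Product using (Σ; _,_; proj₁; proj₂)
open import Data.Sum using (inj₁; inj₂; [_,_]′; map; map₂)
open import Data.Empty using (⊥; ⊥-elim)
open import Data.Fin using (Fin; zero; suc)
open import Data.List using (List; []; _∷_)
open import Data.Unit using (⊤; tt)
open import Function using (id)
open import Relation.Nullary using (¬_; Dec; yes; no)
open import Relation.Binary.PropositionalEquality using (_≡_; _≢_; refl; sym; trans; cong; cong₂; subst; module ≡-Reasoning)

-- A fact a ≤ b is recorded as NonNegative (b - a);
-- nonnegativity is closed under + and *, so an inequality follows once the
-- ring solver writes its difference as a nonnegative combination of known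
-- nonnegative quantities (certify), and a contradiction follows once such a
-- combination equals -1 (refute).

infix 4 _≼_
_≼_ : ℤ → ℤ → Set
a ≼ b = NonNegative (b - a)

not-nonNeg : ∀ {n} → ¬ NonNegative -[1+ n ]
not-nonNeg h = NonNegative.nonNeg h

lit : ∀ n → NonNegative (+ n)
lit _ = _

infixl 6 _⊕_
infixl 7 _⊛_

_⊕_ : ∀ {a b} → NonNegative a → NonNegative b → NonNegative (a + b)
_⊕_ {+ _}       {+ _}       _ _ = _
_⊕_ { -[1+ _ ]} {_}         h _ = ⊥-elim (not-nonNeg h)
_⊕_ {+ _}       { -[1+ _ ]} _ h = ⊥-elim (not-nonNeg h)

_⊛_ : ∀ {a b} → NonNegative a → NonNegative b → NonNegative (a * b)
_⊛_ {+ m}       {+ n}       _ _ = subst NonNegative (pos-* m n) _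
_⊛_ { -[1+ _ ]} {_}         h _ = ⊥-elim (not-nonNeg h)
_⊛_ {+ _}       { -[1+ _ ]} _ h = ⊥-elim (not-nonNeg h)

-- The evidence comes first so that the identity's both sides are known when
-- the ring solver is invoked on it.
certify : ∀ {a b} → NonNegative a → a ≡ b → NonNegative b
certify h refl = h

refute : ∀ {a} → NonNegative a → a ≡ -[1+ 0 ] → ⊥
refute h refl = not-nonNeg h

rewriteˡ : ∀ {a a' c : ℤ} → a ≡ c → a' ≡ a → a' ≡ c
rewriteˡ eq identity = trans identity eq

nonNeg-or-negative : ∀ d → NonNegative d ⊎ NonNegative (- d - + 1)
nonNeg-or-negative (+ _)     = inj₁ _
nonNeg-or-negative -[1+ _ ] = inj₂ _

half-up : ∀ s → + 1 ≼ + 2 * s → + 1 ≼ s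
half-up s h = [ id , (λ s<1 → ⊥-elim (too-small s<1)) ]′ (nonNeg-or-negative (s - + 1))
  where
  too-small : NonNegative (- (s - + 1) - + 1) → ⊥
  too-small s<1 = refute (h ⊕ lit 2 ⊛ s<1) (solve (s ∷ []))

-- Triples form a data type
-- (rather than a product) so that the actions compute on constructor forms
-- and the ring solver sees polynomial goals.  neg is x ↦ -x; σ = diag(-1,1,-1)
-- conjugates B into B⁻¹ and commutes with J.

data Triple : Set where
  ⟨_,_,_⟩ : ℤ → ℤ → ℤ → Triple

actB actB⁻¹ actJ neg σ : Triple → Triple
actB   ⟨ x , y , z ⟩ = ⟨ + 3 * x + + 4 * y , + 2 * x + + 3 * y , z ⟩
actB⁻¹ ⟨ x , y , z ⟩ = ⟨ + 3 * x - + 4 * y , + 3 * y - + 2 * x , z ⟩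
actJ   ⟨ x , y , z ⟩ = ⟨ z , y , x ⟩
neg    ⟨ x , y , z ⟩ = ⟨ - x , - y , - z ⟩
σ      ⟨ x , y , z ⟩ = ⟨ - x , y , - z ⟩

triple-≡ : ∀ {x y z x' y' z' : ℤ} → x ≡ x' → y ≡ y' → z ≡ z' → ⟨ x , y , z ⟩ ≡ ⟨ x' , y' , z' ⟩
triple-≡ refl refl refl = refl

B-neg : ∀ t → actB (neg t) ≡ neg (actB t)
B-neg ⟨ x , y , z ⟩ = triple-≡ (solve (x ∷ y ∷ [])) (solve (x ∷ y ∷ [])) refl

σ-B : ∀ t → actB (σ t) ≡ σ (actB⁻¹ t)
σ-B ⟨ x , y , z ⟩ = triple-≡ (solve (x ∷ y ∷ [])) (solve (x ∷ y ∷ [])) refl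

σ-J : ∀ t → actJ (σ t) ≡ σ (actJ t)
σ-J ⟨ _ , _ , _ ⟩ = refl

σ-involutive : ∀ t → σ (σ t) ≡ t
σ-involutive ⟨ x , y , z ⟩ = triple-≡ (solve (x ∷ [])) refl (solve (z ∷ []))

OnQuadric : Triple → Set
OnQuadric ⟨ x , y , z ⟩ = x * x + z * z - + 2 * (y * y) ≡ + 2

quadric-B : ∀ t → OnQuadric t → OnQuadric (actB t)
quadric-B ⟨ x , y , z ⟩ q = rewriteˡ q (solve (x ∷ y ∷ z ∷ []))

quadric-B⁻¹ : ∀ t → OnQuadric t → OnQuadric (actB⁻¹ t)
quadric-B⁻¹ ⟨ x , y , z ⟩ q = rewriteˡ q (solve (x ∷ y ∷ z ∷ []))

quadric-J : ∀ t → OnQuadric t → OnQuadric (actJ t)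
quadric-J ⟨ x , y , z ⟩ q = rewriteˡ q (solve (x ∷ y ∷ z ∷ []))

quadric-neg : ∀ t → OnQuadric t → OnQuadric (neg t)
quadric-neg ⟨ x , y , z ⟩ q = rewriteˡ q (solve (x ∷ y ∷ z ∷ []))

quadric-σ : ∀ t → OnQuadric t → OnQuadric (σ t)
quadric-σ ⟨ x , y , z ⟩ q = rewriteˡ q (solve (x ∷ y ∷ z ∷ []))

quadric-flipZ : ∀ x y z → OnQuadric ⟨ x , y , z ⟩ → OnQuadric ⟨ x , y , - z ⟩
quadric-flipZ x y z q = rewriteˡ q (solve (x ∷ y ∷ z ∷ []))

-- The key quadratic estimate: on the quadric, y ≥ 1 and x + y ≥ 0 force
-- z ≤ 2x + 3y.  Otherwise, with s = x + y, p = y - 1, e = z - (2x + 3y + 1)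
-- and u = 2s + e, all nonnegative,
--   x² + z² - 2y² - 3 = s² + 2s(p + 1) + 2(p + 1)e + 2p + u(u + 2) ≥ 0,
-- contradicting x² + z² - 2y² - 3 = -1.
quadric-bound : ∀ x y z → OnQuadric ⟨ x , y , z ⟩ → + 1 ≼ y → - y ≼ x → z ≼ + 2 * x + + 3 * y
quadric-bound x y z q hy hs =
  [ id , (λ he → ⊥-elim (too-large he)) ]′ (nonNeg-or-negative ((+ 2 * x + + 3 * y) - z))
  where
  q-3 : x * x + z * z - + 2 * (y * y) - + 3 ≡ -[1+ 0 ]
  q-3 = cong (_- + 3) q
  too-large : NonNegative (- ((+ 2 * x + + 3 * y) - z) - + 1) → ⊥
  too-large he =
    refute (hs ⊛ hs ⊕ lit 2 ⊛ hs ⊛ (hy ⊕ lit 1) ⊕ lit 2 ⊛ (hy ⊕ lit 1) ⊛ he ⊕ lit 2 ⊛ hy ⊕ u ⊛ (u ⊕ lit 2))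
           (rewriteˡ q-3 (solve (x ∷ y ∷ z ∷ [])))
    where u = lit 2 ⊛ hs ⊕ he

-- BCone: x ≥ 3, x > y ≥ |z|, y ≥ 1.  JCone: |x| ≤ y < |z|,
-- y ≥ 1.  Each zone also contains the negatives of its cone points (± P); the
-- B-zone contains in addition the point (-2, -1, 0) = B(-2, 1, 0).

BCone JCone : Triple → Set
BCone ⟨ x , y , z ⟩ = + 3 ≼ x × + 1 ≼ y × y + + 1 ≼ x × - y ≼ z × z ≼ y
JCone ⟨ x , y , z ⟩ = + 1 ≼ y × - y ≼ x × x ≼ y × (y + + 1 ≼ z ⊎ z + + 1 ≼ - y)

±_ : (Triple → Set) → Triple → Set
(± P) t = P t ⊎ P (neg t)

±-map : ∀ {P Q : Triple → Set} (f : Triple → Triple) → (∀ t → f (neg t) ≡ neg (f t)) →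
        (∀ t → P t → Q (f t)) → ∀ t → (± P) t → (± Q) (f t)
±-map f f-neg P⇒Q t (inj₁ p) = inj₁ (P⇒Q t p)
±-map {Q = Q} f f-neg P⇒Q t (inj₂ p) = inj₂ (subst Q (f-neg t) (P⇒Q (neg t) p))

BZone JZone B⁻¹Zone : Triple → Set
BZone t   = (± BCone) t ⊎ t ≡ ⟨ - + 2 , - + 1 , + 0 ⟩
JZone     = ± JCone
B⁻¹Zone t = BZone (σ t)

to-bCone : ∀ x y z → + 1 ≼ y → + 1 ≼ x + y → - (+ 2 * x + + 3 * y) ≼ z → z ≼ + 2 * x + + 3 * y →
           BCone (actB ⟨ x , y , z ⟩)
to-bCone x y z hy hs lower upper =
  certify (lit 3 ⊛ hs ⊕ hy ⊕ lit 1) (solve (x ∷ y ∷ [])) ,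
  certify (lit 2 ⊛ hs ⊕ hy ⊕ lit 2) (solve (x ∷ y ∷ [])) ,
  certify hs (solve (x ∷ y ∷ [])) ,
  lower , upper

bCone-B : ∀ t → BCone t → BCone (actB t)
bCone-B ⟨ x , y , z ⟩ (hx , hy , _ , lower , upper) = to-bCone x y z hy
  (certify (hx ⊕ hy ⊕ lit 3) (solve (x ∷ y ∷ [])))
  (certify (lower ⊕ lit 2 ⊛ hx ⊕ lit 2 ⊛ hy ⊕ lit 8) (solve (x ∷ y ∷ z ∷ [])))
  (certify (upper ⊕ lit 2 ⊛ hx ⊕ lit 2 ⊛ hy ⊕ lit 8) (solve (x ∷ y ∷ z ∷ [])))

-- B maps quadric points of the J-cone into the B-cone; this is where
-- quadric-bound is used, applied to z or to -z.
jCone-B : ∀ t → OnQuadric t → JCone t → BCone (actB t)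
jCone-B ⟨ x , y , z ⟩ q (hy , hs , _ , inj₁ above) = to-bCone x y z hy
  (half-up (x + y) (certify (upper ⊕ above) (solve (x ∷ y ∷ z ∷ []))))
  (certify (above ⊕ lit 2 ⊛ hs ⊕ lit 2 ⊛ hy ⊕ lit 3) (solve (x ∷ y ∷ z ∷ [])))
  upper
  where upper = quadric-bound x y z q hy hs
jCone-B ⟨ x , y , z ⟩ q (hy , hs , _ , inj₂ below) = to-bCone x y z hy
  (half-up (x + y) (certify (lower ⊕ below) (solve (x ∷ y ∷ z ∷ []))))
  (certify lower (solve (x ∷ y ∷ z ∷ [])))
  (certify (below ⊕ lit 2 ⊛ hs ⊕ lit 2 ⊛ hy ⊕ lit 3) (solve (x ∷ y ∷ z ∷ [])))
  where lower = quadric-bound x y (- z) (quadric-flipZ x y z q) hy hs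

bCone-J : ∀ t → BCone t → JCone (actJ t)
bCone-J ⟨ _ , _ , _ ⟩ (_ , hy , hxy , lower , upper) = hy , lower , upper , inj₁ hxy

jCone-σ : ∀ t → JCone t → JCone (σ t)
jCone-σ ⟨ x , y , z ⟩ (hy , lower , upper , far) =
  hy , certify upper (solve (x ∷ y ∷ [])) , certify lower (solve (x ∷ y ∷ [])) , flip far
  where
  flip : y + + 1 ≼ z ⊎ z + + 1 ≼ - y → y + + 1 ≼ - z ⊎ - z + + 1 ≼ - y
  flip (inj₁ above) = inj₂ (certify above (solve (y ∷ z ∷ [])))
  flip (inj₂ below) = inj₁ (certify below (solve (y ∷ z ∷ [])))

bZone-B : ∀ t → BZone t → BZone (actB t)
bZone-B t (inj₁ h)    = inj₁ (±-map {BCone} {BCone} actB B-neg bCone-B t h)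
bZone-B _ (inj₂ refl) = inj₁ (inj₂ _)

jZone-B : ∀ t → OnQuadric t → JZone t → BZone (actB t)
jZone-B t q (inj₁ h) = inj₁ (inj₁ (jCone-B t q h))
jZone-B t q (inj₂ h) = inj₁ (inj₂ (subst BCone (B-neg t) (jCone-B (neg t) (quadric-neg t q) h)))

bZone-J : ∀ t → BZone t → JZone (actJ t)
bZone-J t (inj₁ h)    = ±-map {BCone} {JCone} actJ (λ { ⟨ _ , _ , _ ⟩ → refl }) bCone-J t h
bZone-J _ (inj₂ refl) = inj₂ (_ , _ , _ , inj₁ _)

jZone-σ : ∀ t → JZone t → JZone (σ t)
jZone-σ = ±-map {JCone} {JCone} σ (λ { ⟨ _ , _ , _ ⟩ → refl }) jCone-σ

b⁻¹Zone-B⁻¹ : ∀ t → B⁻¹Zone t → B⁻¹Zone (actB⁻¹ t)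
b⁻¹Zone-B⁻¹ t h = subst BZone (σ-B t) (bZone-B (σ t) h)

jZone-B⁻¹ : ∀ t → OnQuadric t → JZone t → B⁻¹Zone (actB⁻¹ t)
jZone-B⁻¹ t q h = subst BZone (σ-B t) (jZone-B (σ t) (quadric-σ t q) (jZone-σ t h))

b⁻¹Zone-J : ∀ t → B⁻¹Zone t → JZone (actJ t)
b⁻¹Zone-J t h =
  subst JZone (σ-involutive (actJ t)) (jZone-σ (σ (actJ t)) (subst JZone (σ-J t) (bZone-J (σ t) h)))

-- Seeds: Δ₂ together with (1, 0, -1), which makes the set σ-stable.  One letter
-- sends a seed into the corresponding zone, except that J may give a seed back.

data Δ₂-point : Triple → Set where
  even₊ : Δ₂-point ⟨ + 2 , + 1 , + 0 ⟩
  even₋ : Δ₂-point ⟨ - + 2 , + 1 , + 0 ⟩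
  odd₊₊ : Δ₂-point ⟨ + 1 , + 0 , + 1 ⟩
  odd₋₊ : Δ₂-point ⟨ - + 1 , + 0 , + 1 ⟩
  odd₋₋ : Δ₂-point ⟨ - + 1 , + 0 , - + 1 ⟩

data Seed : Triple → Set where
  from-Δ₂ : ∀ {t} → Δ₂-point t → Seed t
  odd₊₋   : Seed ⟨ + 1 , + 0 , - + 1 ⟩

seed-quadric : ∀ {t} → Seed t → OnQuadric t
seed-quadric (from-Δ₂ even₊) = refl
seed-quadric (from-Δ₂ even₋) = refl
seed-quadric (from-Δ₂ odd₊₊) = refl
seed-quadric (from-Δ₂ odd₋₊) = refl
seed-quadric (from-Δ₂ odd₋₋) = refl
seed-quadric odd₊₋           = refl

seed-σ : ∀ {t} → Seed t → Seed (σ t)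
seed-σ (from-Δ₂ even₊) = from-Δ₂ even₋
seed-σ (from-Δ₂ even₋) = from-Δ₂ even₊
seed-σ (from-Δ₂ odd₊₊) = from-Δ₂ odd₋₋
seed-σ (from-Δ₂ odd₋₊) = odd₊₋
seed-σ (from-Δ₂ odd₋₋) = from-Δ₂ odd₊₊
seed-σ odd₊₋           = from-Δ₂ odd₋₊

seed-B : ∀ {t} → Seed t → BZone (actB t)
seed-B (from-Δ₂ even₊) = inj₁ (inj₁ _)
seed-B (from-Δ₂ even₋) = inj₂ refl
seed-B (from-Δ₂ odd₊₊) = inj₁ (inj₁ _)
seed-B (from-Δ₂ odd₋₊) = inj₁ (inj₂ _)
seed-B (from-Δ₂ odd₋₋) = inj₁ (inj₂ _)
seed-B odd₊₋           = inj₁ (inj₁ _)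

seed-J : ∀ {t} → Seed t → JZone (actJ t) ⊎ Seed (actJ t)
seed-J (from-Δ₂ even₊) = inj₁ (inj₁ (_ , _ , _ , inj₁ _))
seed-J (from-Δ₂ even₋) = inj₁ (inj₁ (_ , _ , _ , inj₂ _))
seed-J (from-Δ₂ odd₊₊) = inj₂ (from-Δ₂ odd₊₊)
seed-J (from-Δ₂ odd₋₊) = inj₂ odd₊₋
seed-J (from-Δ₂ odd₋₋) = inj₂ (from-Δ₂ odd₋₋)
seed-J odd₊₋           = inj₂ (from-Δ₂ odd₋₊)

seed-B⁻¹ : ∀ {t} → Seed t → B⁻¹Zone (actB⁻¹ t)
seed-B⁻¹ {t} s = subst BZone (σ-B t) (seed-B (seed-σ s))

-- Seeds lie in no zone: they have |x| ≤ 2 and |z| ≤ 1, whereas the B-cone needs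
-- x ≥ 3 and the J-cone |z| ≥ 2.

seed-small : ∀ {x y z} → Seed ⟨ x , y , z ⟩ → x ≼ + 2 × - x ≼ + 2 × z ≼ + 1 × - z ≼ + 1
seed-small (from-Δ₂ even₊) = _
seed-small (from-Δ₂ even₋) = _
seed-small (from-Δ₂ odd₊₊) = _
seed-small (from-Δ₂ odd₋₊) = _
seed-small (from-Δ₂ odd₋₋) = _
seed-small odd₊₋           = _

narrow∉BCone : ∀ x y z → x ≼ + 2 → ¬ BCone ⟨ x , y , z ⟩
narrow∉BCone x y z narrow (x≥3 , _) = refute (narrow ⊕ x≥3) (solve (x ∷ []))

flat∉JCone : ∀ x y z → z ≼ + 1 → - z ≼ + 1 → ¬ JCone ⟨ x , y , z ⟩
flat∉JCone x y z z≤1 _ (y≥1 , _ , _ , inj₁ above) = refute (above ⊕ y≥1 ⊕ z≤1) (solve (y ∷ z ∷ []))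
flat∉JCone x y z _ z≥-1 (y≥1 , _ , _ , inj₂ below) = refute (below ⊕ y≥1 ⊕ z≥-1) (solve (y ∷ z ∷ []))

seed∉BZone : ∀ {t} → Seed t → ¬ BZone t
seed∉BZone {⟨ x , y , z ⟩} s (inj₁ (inj₁ h)) = narrow∉BCone x y z (proj₁ (seed-small s)) h
seed∉BZone {⟨ x , y , z ⟩} s (inj₁ (inj₂ h)) = narrow∉BCone (- x) (- y) (- z) (proj₁ (proj₂ (seed-small s))) h
seed∉BZone (from-Δ₂ ()) (inj₂ refl)

seed∉JZone : ∀ {t} → Seed t → ¬ JZone t
seed∉JZone {⟨ x , y , z ⟩} s h =
  let (_ , _ , z≤1 , z≥-1) = seed-small s in
  [ flat∉JCone x y z z≤1 z≥-1
  , flat∉JCone (- x) (- y) (- z) z≥-1 (certify z≤1 (solve (z ∷ [])))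
  ]′ h

data Gen : Set where
  gB gB⁻¹ gJ : Gen

inverse : Gen → Gen
inverse gB   = gB⁻¹
inverse gB⁻¹ = gB
inverse gJ   = gJ

act : Gen → Triple → Triple
act gB   = actB
act gB⁻¹ = actB⁻¹
act gJ   = actJ

evalWord : List Gen → Triple → Triple
evalWord []      t = t
evalWord (g ∷ w) t = act g (evalWord w t)

Reduced : List Gen → Set
Reduced []          = ⊤
Reduced (_ ∷ [])     = ⊤
Reduced (g ∷ h ∷ w) = h ≢ inverse g × Reduced (h ∷ w)

reduced-tail : ∀ g w → Reduced (g ∷ w) → Reduced w
reduced-tail _ []      _       = tt
reduced-tail _ (_ ∷ _) (_ , r) = r

quadric-act : ∀ g t → OnQuadric t → OnQuadric (act g t)
quadric-act gB   = quadric-B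
quadric-act gB⁻¹ = quadric-B⁻¹
quadric-act gJ   = quadric-J

quadric-eval : ∀ w t → OnQuadric t → OnQuadric (evalWord w t)
quadric-eval []      t q = q
quadric-eval (g ∷ w) t q = quadric-act g (evalWord w t) (quadric-eval w t q)

-- Where a reduced word sends a seed, according to its first letter; the
-- clause for J records that only the one-letter word J may end at a seed.
Reach : List Gen → Triple → Set
Reach []         t = Seed t
Reach (gB ∷ _)   t = BZone t
Reach (gB⁻¹ ∷ _) t = B⁻¹Zone t
Reach (gJ ∷ w)   t = JZone t ⊎ (w ≡ [] × Seed t)

step : ∀ g w {t} → Reduced (g ∷ w) → OnQuadric t → Reach w t → Reach (g ∷ w) (act g t)
step gB   []         _               _ h              = seed-B h
step gB   (gB ∷ _)   _               _ h              = bZone-B _ h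
step gB   (gB⁻¹ ∷ _) (no-cancel , _) _ _              = ⊥-elim (no-cancel refl)
step gB   (gJ ∷ _)   _               q (inj₁ h)       = jZone-B _ q h
step gB   (gJ ∷ _)   _               _ (inj₂ (_ , h)) = seed-B h
step gB⁻¹ []         _               _ h              = seed-B⁻¹ h
step gB⁻¹ (gB ∷ _)   (no-cancel , _) _ _              = ⊥-elim (no-cancel refl)
step gB⁻¹ (gB⁻¹ ∷ _) _               _ h              = b⁻¹Zone-B⁻¹ _ h
step gB⁻¹ (gJ ∷ _)   _               q (inj₁ h)       = jZone-B⁻¹ _ q h
step gB⁻¹ (gJ ∷ _)   _               _ (inj₂ (_ , h)) = seed-B⁻¹ h
step gJ   []         _               _ h              = map₂ (refl ,_) (seed-J h)
step gJ   (gB ∷ _)   _               _ h              = inj₁ (bZone-J _ h)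
step gJ   (gB⁻¹ ∷ _) _               _ h              = inj₁ (b⁻¹Zone-J _ h)
step gJ   (gJ ∷ _)   (no-cancel , _) _ _              = ⊥-elim (no-cancel refl)

reach : ∀ w {t} → Reduced w → Seed t → Reach w (evalWord w t)
reach []      _ s = s
reach (g ∷ w) {t} r s =
  step g w r (quadric-eval w t (seed-quadric s)) (reach w (reduced-tail g w r) s)

leaves-seeds : ∀ g w {t} → Reach (g ∷ w) t → Seed t → g ∷ w ≡ gJ ∷ []
leaves-seeds gB   _ h                 s = ⊥-elim (seed∉BZone s h)
leaves-seeds gB⁻¹ _ h                 s = ⊥-elim (seed∉BZone (seed-σ s) h)
leaves-seeds gJ   _ (inj₁ h)          s = ⊥-elim (seed∉JZone s h)
leaves-seeds gJ   _ (inj₂ (refl , _)) _ = refl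

ping-pong : ∀ w {t} → Reduced w → Seed t → Seed (evalWord w t) → w ≡ [] ⊎ w ≡ gJ ∷ []
ping-pong []      _ _ _  = inj₁ refl
ping-pong (g ∷ w) r s s' = inj₂ (leaves-seeds g w (reach (g ∷ w) r s) s')

toVec : Triple → Vec3
toVec ⟨ x , y , z ⟩ = vec x y z

matrix : Gen → Mat3
matrix gB   = B
matrix gB⁻¹ = B⁻¹
matrix gJ   = J

row-e₀ : ∀ x y z → + 1 * x + (+ 0 * y + + 0 * z) ≡ x
row-e₀ = solve-∀
row-e₁ : ∀ x y z → + 0 * x + (+ 1 * y + + 0 * z) ≡ y
row-e₁ = solve-∀
row-e₂ : ∀ x y z → + 0 * x + (+ 0 * y + + 1 * z) ≡ z
row-e₂ = solve-∀

matrix-act : ∀ g t → (matrix g · toVec t) ≈V toVec (act g t)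
matrix-act gB ⟨ x , y , z ⟩ zero = row x y z
  where row : ∀ x y z → + 3 * x + (+ 4 * y + + 0 * z) ≡ + 3 * x + + 4 * y
        row = solve-∀
matrix-act gB ⟨ x , y , z ⟩ (suc zero) = row x y z
  where row : ∀ x y z → + 2 * x + (+ 3 * y + + 0 * z) ≡ + 2 * x + + 3 * y
        row = solve-∀
matrix-act gB⁻¹ ⟨ x , y , z ⟩ zero = row x y z
  where row : ∀ x y z → + 3 * x + (- + 4 * y + + 0 * z) ≡ + 3 * x - + 4 * y
        row = solve-∀
matrix-act gB⁻¹ ⟨ x , y , z ⟩ (suc zero) = row x y z
  where row : ∀ x y z → - + 2 * x + (+ 3 * y + + 0 * z) ≡ + 3 * y - + 2 * x
        row = solve-∀
matrix-act gB   ⟨ x , y , z ⟩ (suc (suc zero)) = row-e₂ x y z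
matrix-act gB⁻¹ ⟨ x , y , z ⟩ (suc (suc zero)) = row-e₂ x y z
matrix-act gJ   ⟨ x , y , z ⟩ zero             = row-e₂ x y z
matrix-act gJ   ⟨ x , y , z ⟩ (suc zero)       = row-e₁ x y z
matrix-act gJ   ⟨ x , y , z ⟩ (suc (suc zero)) = row-e₀ x y z

identity-act : ∀ t → (I₃ · toVec t) ≈V toVec t
identity-act ⟨ x , y , z ⟩ zero             = row-e₀ x y z
identity-act ⟨ x , y , z ⟩ (suc zero)       = row-e₁ x y z
identity-act ⟨ x , y , z ⟩ (suc (suc zero)) = row-e₂ x y z

unit : Fin 3 → Triple
unit zero             = ⟨ + 1 , + 0 , + 0 ⟩
unit (suc zero)       = ⟨ + 0 , + 1 , + 0 ⟩
unit (suc (suc zero)) = ⟨ + 0 , + 0 , + 1 ⟩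

column : ∀ M r c → (M · toVec (unit c)) r ≡ M r c
column M r zero             = col (M r zero) (M r (suc zero)) (M r (suc (suc zero)))
  where col : ∀ a b c → a * + 1 + (b * + 0 + c * + 0) ≡ a
        col = solve-∀
column M r (suc zero)       = col (M r zero) (M r (suc zero)) (M r (suc (suc zero)))
  where col : ∀ a b c → a * + 0 + (b * + 1 + c * + 0) ≡ b
        col = solve-∀
column M r (suc (suc zero)) = col (M r zero) (M r (suc zero)) (M r (suc (suc zero)))
  where col : ∀ a b c → a * + 0 + (b * + 0 + c * + 1) ≡ c
        col = solve-∀

·-assoc : ∀ M N v → ((M ⊗ N) · v) ≈V (M · (N · v))
·-assoc M N v r = expand (M r zero) (M r (suc zero)) (M r (suc (suc zero)))
  (N zero zero) (N zero (suc zero)) (N zero (suc (suc zero)))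
  (N (suc zero) zero) (N (suc zero) (suc zero)) (N (suc zero) (suc (suc zero)))
  (N (suc (suc zero)) zero) (N (suc (suc zero)) (suc zero)) (N (suc (suc zero)) (suc (suc zero)))
  (v zero) (v (suc zero)) (v (suc (suc zero)))
  where
  expand : ∀ a₀ a₁ a₂ n₀₀ n₀₁ n₀₂ n₁₀ n₁₁ n₁₂ n₂₀ n₂₁ n₂₂ v₀ v₁ v₂ →
    (a₀ * n₀₀ + (a₁ * n₁₀ + a₂ * n₂₀)) * v₀ + ((a₀ * n₀₁ + (a₁ * n₁₁ + a₂ * n₂₁)) * v₁ + (a₀ * n₀₂ + (a₁ * n₁₂ + a₂ * n₂₂)) * v₂)
    ≡ a₀ * (n₀₀ * v₀ + (n₀₁ * v₁ + n₀₂ * v₂)) + (a₁ * (n₁₀ * v₀ + (n₁₁ * v₁ + n₁₂ * v₂)) + a₂ * (n₂₀ * v₀ + (n₂₁ * v₁ + n₂₂ * v₂)))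
  expand = solve-∀

·-cong : ∀ M {u v} → u ≈V v → (M · u) ≈V (M · v)
·-cong M u≈v r = cong₂ _+_ (cong (M r zero *_) (u≈v zero))
                   (cong₂ _+_ (cong (M r (suc zero) *_) (u≈v (suc zero))) (cong (M r (suc (suc zero)) *_) (u≈v (suc (suc zero)))))

Realises : Mat3 → List Gen → Set
Realises M w = ∀ t → (M · toVec t) ≈V toVec (evalWord w t)

realises-unique : ∀ {M N} w → Realises M w → Realises N w → M ≈M N
realises-unique {M} {N} w M-w N-w r c = begin
  M r c                                ≡⟨ sym (column M r c) ⟩
  (M · toVec (unit c)) r               ≡⟨ M-w (unit c) r ⟩
  toVec (evalWord w (unit c)) r        ≡⟨ sym (N-w (unit c) r) ⟩
  (N · toVec (unit c)) r               ≡⟨ column N r c ⟩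
  N r c                                ∎
  where open ≡-Reasoning

_≟_ : (g h : Gen) → Dec (g ≡ h)
gB   ≟ gB   = yes refl
gB⁻¹ ≟ gB⁻¹ = yes refl
gJ   ≟ gJ   = yes refl
gB   ≟ gB⁻¹ = no λ ()
gB   ≟ gJ   = no λ ()
gB⁻¹ ≟ gB   = no λ ()
gB⁻¹ ≟ gJ   = no λ ()
gJ   ≟ gB   = no λ ()
gJ   ≟ gB⁻¹ = no λ ()

prepend : Gen → List Gen → List Gen
prepend g []      = g ∷ []
prepend g (h ∷ w) with h ≟ inverse g
... | yes _ = w
... | no  _ = g ∷ h ∷ w

prepend-reduced : ∀ g w → Reduced w → Reduced (prepend g w)
prepend-reduced g []      _ = tt
prepend-reduced g (h ∷ w) r with h ≟ inverse g
... | yes _   = reduced-tail h w r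
... | no  h≢ = h≢ , r

inverse-cancels : ∀ g t → act g (act (inverse g) t) ≡ t
inverse-cancels gB   ⟨ x , y , z ⟩ = triple-≡ (solve (x ∷ y ∷ [])) (solve (x ∷ y ∷ [])) refl
inverse-cancels gB⁻¹ ⟨ x , y , z ⟩ = triple-≡ (solve (x ∷ y ∷ [])) (solve (x ∷ y ∷ [])) refl
inverse-cancels gJ   ⟨ x , y , z ⟩ = refl

prepend-eval : ∀ g w t → evalWord (prepend g w) t ≡ act g (evalWord w t)
prepend-eval g []      t = refl
prepend-eval g (h ∷ w) t with h ≟ inverse g
... | yes refl = sym (inverse-cancels g (evalWord w t))
... | no  _    = refl

realises-prepend : ∀ g {N} w → Realises N w → Realises (matrix g ⊗ N) (prepend g w)
realises-prepend g {N} w N-w t r = begin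
  ((matrix g ⊗ N) · toVec t) r             ≡⟨ ·-assoc (matrix g) N (toVec t) r ⟩
  (matrix g · (N · toVec t)) r             ≡⟨ ·-cong (matrix g) (N-w t) r ⟩
  (matrix g · toVec (evalWord w t)) r      ≡⟨ matrix-act g (evalWord w t) r ⟩
  toVec (act g (evalWord w t)) r           ≡⟨ cong (λ u → toVec u r) (sym (prepend-eval g w t)) ⟩
  toVec (evalWord (prepend g w) t) r       ∎
  where open ≡-Reasoning

NormalForm : Mat3 → Set
NormalForm M = Σ (List Gen) λ w → Reduced w × Realises M w

prepend-normal-form : ∀ g N → NormalForm N → NormalForm (matrix g ⊗ N)
prepend-normal-form g N (w , r , N-w) =
  prepend g w , prepend-reduced g w r , realises-prepend g {N} w N-w

normal-form : ∀ {M} → InH M → NormalForm M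
normal-form h-I             = [] , tt , identity-act
normal-form (h-B   {N} h) = prepend-normal-form gB   N (normal-form h)
normal-form (h-B⁻¹ {N} h) = prepend-normal-form gB⁻¹ N (normal-form h)
normal-form (h-J   {N} h) = prepend-normal-form gJ   N (normal-form h)

toVec-injective : ∀ t t' → toVec t ≈V toVec t' → t ≡ t'
toVec-injective ⟨ _ , _ , _ ⟩ ⟨ _ , _ , _ ⟩ e = triple-≡ (e zero) (e (suc zero)) (e (suc (suc zero)))

classify-normal-form : ∀ {M t t'} → NormalForm M → Seed t → Seed t' → (M · toVec t) ≈V toVec t' →
                       (M ≈M I₃ × t ≡ t') ⊎ (M ≈M J × actJ t ≡ t')
classify-normal-form {M} {t} {t'} (w , r , M-w) s s' M·t≈t'
  with refl ← toVec-injective (evalWord w t) t' (λ i → trans (sym (M-w t i)) (M·t≈t' i))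
  with ping-pong w r s s'
... | inj₁ refl = inj₁ (realises-unique [] M-w identity-act , refl)
... | inj₂ refl = inj₂ (realises-unique (gJ ∷ []) M-w (matrix-act gJ) , refl)

JFixed : Vec3 → Set
JFixed δ = (δ ≈V vec (+ 1) (+ 0) (+ 1)) ⊎ (δ ≈V vec (- (+ 1)) (+ 0) (- (+ 1)))

JFixed-resp : ∀ {δ δ''} → δ ≈V δ'' → JFixed δ'' → JFixed δ
JFixed-resp δ≈δ'' = map (λ e r → trans (δ≈δ'' r) (e r)) (λ e r → trans (δ≈δ'' r) (e r))

as-triple : ∀ {δ} → InΔ₂ δ → Σ Triple λ t → Δ₂-point t × δ ≈V toVec t
as-triple (even e1) = _ , even₊ , λ _ → refl
as-triple (even e2) = _ , even₋ , λ _ → refl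
as-triple (odd o1)  = _ , odd₊₊ , λ _ → refl
as-triple (odd o2)  = _ , odd₋₊ , λ _ → refl
as-triple (odd o3)  = _ , odd₋₋ , λ _ → refl

J-on-Δ₂ : ∀ {t} → Δ₂-point t → Δ₂-point (actJ t) → actJ t ≡ t × JFixed (toVec t)
J-on-Δ₂ even₊ ()
J-on-Δ₂ even₋ ()
J-on-Δ₂ odd₊₊ _ = refl , inj₁ λ _ → refl
J-on-Δ₂ odd₋₊ ()
J-on-Δ₂ odd₋₋ _ = refl , inj₂ λ _ → refl

same-vector : ∀ {δ δ' t t'} → δ ≈V toVec t → δ' ≈V toVec t' → t ≡ t' → δ ≈V δ'
same-vector δ≈t δ'≈t' refl r = trans (δ≈t r) (sym (δ'≈t' r))

Outcome : Mat3 → Vec3 → Set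
Outcome M δ = (M ≈M I₃) ⊎ ((M ≈M J) × JFixed δ)

classify-Δ₂ : ∀ {M δ δ'} → InH M → InΔ₂ δ → InΔ₂ δ' → (M · δ) ≈V δ' → Outcome M δ × δ ≈V δ'
classify-Δ₂ {M} h iδ iδ' eq
  with (t , p , δ≈t) ← as-triple iδ | (t' , p' , δ'≈t') ← as-triple iδ'
  with classify-normal-form (normal-form h) (from-Δ₂ p) (from-Δ₂ p')
         (λ r → trans (·-cong M (λ i → sym (δ≈t i)) r) (trans (eq r) (δ'≈t' r)))
... | inj₁ (M≈I , t≡t') = inj₁ M≈I , same-vector δ≈t δ'≈t' t≡t'
... | inj₂ (M≈J , refl) with J-on-Δ₂ p p'
...   | Jt≡t , fixed = inj₂ (M≈J , JFixed-resp δ≈t fixed) , same-vector δ≈t δ'≈t' (sym Jt≡t)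

even⇒identity : ∀ {M δ} → EvenΔ₂ δ → Outcome M δ → M ≈M I₃
even⇒identity _  (inj₁ M≈I)          = M≈I
even⇒identity e1 (inj₂ (_ , inj₁ δ≈)) with () ← δ≈ zero
even⇒identity e1 (inj₂ (_ , inj₂ δ≈)) with () ← δ≈ zero
even⇒identity e2 (inj₂ (_ , inj₁ δ≈)) with () ← δ≈ zero
even⇒identity e2 (inj₂ (_ , inj₂ δ≈)) with () ← δ≈ zero

lemma7p7 : (M : Mat3) (δ δ' : Vec3) → InH M → InΔ₂ δ → InΔ₂ δ' → (M · δ) ≈V δ' →
    ((OddΔ₂ δ → (M ≈M I₃) ⊎ ((M ≈M J) × ((δ ≈V vec (+ 1) (+ 0) (+ 1)) ⊎ (δ ≈V vec (- (+ 1)) (+ 0) (- (+ 1))))))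
    × (EvenΔ₂ δ → M ≈M I₃)
    × (δ ≈V δ'))
lemma7p7 M δ δ' h iδ iδ' eq =
  let (outcome , δ≈δ') = classify-Δ₂ h iδ iδ' eq
  in (λ _ → outcome) , (λ even-δ → even⇒identity even-δ outcome) , δ≈δ'
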